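{- Let $n,m\in\mathbb N$ with $n<m$. Then $\mathbb P^T_n\cap\mathbb P^T_m\ne\emptyset$ if and only if $m\in\mathbb P^T_n$. Moreover, if $m\in\mathbb P^T_n$, say $m=p^{(k)}_n$, then $\mathbb P^T_m\subset\mathbb P^T_n$ and $$\mathbb P^T_n\setminus\mathbb P^T_m=\{p^{(1)}_n,p^{(2)}_n,\dots,p^{(k)}_n\}.$$
   Context: Let $p_n$ denote the $n$-th prime number ($p_1=2$). Define $p^{(0)}_n=n$ and recursively $p^{(k+1)}_n=p_{p^{(k)}_n}$ for $k\in\mathbb N_0$. For $n\in\mathbb N$, $\mathbb P^T_n=\{p^{(k)}_n: k\in\mathbb N\}=\{p^{(1)}_n<p^{(2)}_n<\cdots\}$. -}

module Defs where

open import Data.Nat using (ℕ; zero; suc; _+_; _<_; _≤_; _!)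
open import Data.Nat.Primality using (Prime; prime?)
open import Data.Product using (Σ; _×_)
open import Relation.Nullary using (yes; no)
open import Relation.Binary.PropositionalEquality using (_≡_)

-- Smallest prime among  m+1, m+2, ..., m+fuel  (returns m+fuel+1 if none,
-- which never happens when called below).
searchPrime : ℕ → ℕ → ℕ
searchPrime m zero = suc m
searchPrime m (suc fuel) with prime? (suc m)
... | yes _ = suc m
... | no  _ = searchPrime (suc m) fuel

-- The least prime strictly greater than m. By Euclid's argument there is
-- always a prime in (m, m ! + 1], so a search of length m ! + 1 suffices.
nextPrime : ℕ → ℕ
nextPrime m = searchPrime m (suc (m !))

-- p n = the n-th prime, with p 1 = 2 (p 0 = 2 as an irrelevant junk value).
p : ℕ → ℕ
p zero          = 2
p (suc zero)    = 2
p (suc (suc n)) = nextPrime (p (suc n))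

pIter : ℕ → ℕ → ℕ
pIter zero    n = n
pIter (suc k) n = p (pIter k n)

_∈PT_ : ℕ → ℕ → Set
x ∈PT n = Σ ℕ (λ k → (1 ≤ k) × (pIter k n ≡ x))

open import Relation.Binary.PropositionalEquality using (refl)
_ : p 1 ≡ 2
_ = refl
_ : p 5 ≡ 11
_ = refl
_ : pIter 2 2 ≡ 5
_ = refl

{-# OPTIONS --safe #-}
module Submission where

-- Since p is strictly increasing on positive arguments, it is injective there, so an
-- equation p^(i)_n = p^(j)_m can be cancelled one p at a time until one of n, m is an
-- iterate of the other. As p x > x, the orbit n, p^(1)_n, p^(2)_n, ... is strictly
-- increasing; hence if m = p^(k)_n then P^T_m is exactly the tail of that orbit beyond
-- index k, and what remains of P^T_n are its first k terms.

open import Defs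
open import Data.Nat using (ℕ; zero; suc; _+_; _∸_; _≤_; _<_; z≤n; s≤s; _≤?_)
open import Data.Nat.Properties
open import Data.Nat.Primality using (prime?)
open import Data.Product using (Σ; _×_; _,_)
open import Data.Sum using (_⊎_; inj₁; inj₂)
open import Data.Empty using (⊥-elim)
open import Function.Bundles using (_⇔_; mk⇔)
open import Relation.Nullary using (¬_; yes; no)
open import Relation.Binary.Definitions using (tri<; tri≈; tri>)
open import Relation.Binary.PropositionalEquality
  using (_≡_; refl; sym; trans; cong; subst; module ≡-Reasoning)

searchPrime-> : ∀ m fuel → m < searchPrime m fuel
searchPrime-> m zero = ≤-refl
searchPrime-> m (suc fuel) with prime? (suc m)
... | yes _ = ≤-refl
... | no  _ = <-trans (n<1+n m) (searchPrime-> (suc m) fuel)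

p-<-p-suc : ∀ {n} → 1 ≤ n → p n < p (suc n)
p-<-p-suc {suc n} _ = searchPrime-> (p (suc n)) _

n<p[n] : ∀ n → n < p n
n<p[n] zero          = s≤s z≤n
n<p[n] (suc zero)    = s≤s (s≤s z≤n)
n<p[n] (suc (suc n)) = <-≤-trans (s≤s (n<p[n] (suc n))) (p-<-p-suc {suc n} (s≤s z≤n))

p-strictMono : ∀ {a b} → 1 ≤ a → a < b → p a < p b
p-strictMono {a} {suc b} 1≤a (s≤s a≤b) with m≤n⇒m<n∨m≡n a≤b
... | inj₂ refl = p-<-p-suc 1≤a
... | inj₁ a<b  = <-trans (p-strictMono 1≤a a<b) (p-<-p-suc (≤-trans 1≤a a≤b))

p-injective : ∀ {a b} → 1 ≤ a → 1 ≤ b → p a ≡ p b → a ≡ b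
p-injective {a} {b} 1≤a 1≤b pa≡pb with <-cmp a b
... | tri< a<b _ _ = ⊥-elim (<-irrefl pa≡pb (p-strictMono 1≤a a<b))
... | tri≈ _ a≡b _ = a≡b
... | tri> _ _ b<a = ⊥-elim (<-irrefl (sym pa≡pb) (p-strictMono 1≤b b<a))

pIter-+ : ∀ j k n → pIter j (pIter k n) ≡ pIter (j + k) n
pIter-+ zero    k n = refl
pIter-+ (suc j) k n = cong p (pIter-+ j k n)

pIter-positive : ∀ k {n} → 1 ≤ n → 1 ≤ pIter k n
pIter-positive zero    1≤n = 1≤n
pIter-positive (suc k) {n} _ = ≤-trans (s≤s z≤n) (n<p[n] (pIter k n))

n<pIter-suc : ∀ k n → n < pIter (suc k) n
n<pIter-suc zero    n = n<p[n] n
n<pIter-suc (suc k) n = <-trans (n<pIter-suc k n) (n<p[n] _)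

pIter-inflationary : ∀ k n → n ≤ pIter k n
pIter-inflationary zero    n = ≤-refl
pIter-inflationary (suc k) n = <⇒≤ (n<pIter-suc k n)

pIter-split : ∀ {j k} n → j ≤ k → pIter (k ∸ j) (pIter j n) ≡ pIter k n
pIter-split {j} {k} n j≤k = trans (pIter-+ (k ∸ j) j n) (cong (λ i → pIter i n) (m∸n+n≡m j≤k))

pIter-monoˡ-≤ : ∀ {j k} n → j ≤ k → pIter j n ≤ pIter k n
pIter-monoˡ-≤ {j} {k} n j≤k =
  subst (pIter j n ≤_) (pIter-split n j≤k) (pIter-inflationary (k ∸ j) (pIter j n))

pIter-common : ∀ i j {n m} → 1 ≤ n → 1 ≤ m → pIter i n ≡ pIter j m →
  Σ ℕ (λ d → pIter d n ≡ m) ⊎ Σ ℕ (λ d → pIter d m ≡ n)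
pIter-common zero    j       _   _   e = inj₂ (j , sym e)
pIter-common (suc i) zero    _   _   e = inj₁ (suc i , e)
pIter-common (suc i) (suc j) 1≤n 1≤m e =
  pIter-common i j 1≤n 1≤m (p-injective (pIter-positive i 1≤n) (pIter-positive j 1≤m) e)

∈PT⇒> : ∀ {x m} → x ∈PT m → m < x
∈PT⇒> {m = m} (suc i , _ , e) = subst (m <_) e (n<pIter-suc i m)

∈PT-trans : ∀ {k n m x} → pIter k n ≡ m → x ∈PT m → x ∈PT n
∈PT-trans {k} {n} {m} {x} ek (j , 1≤j , e) = j + k , ≤-trans 1≤j (m≤m+n j k) , (begin
  pIter (j + k) n     ≡⟨ sym (pIter-+ j k n) ⟩
  pIter j (pIter k n) ≡⟨ cong (pIter j) ek ⟩
  pIter j m           ≡⟨ e ⟩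
  x                   ∎)
  where open ≡-Reasoning

pIter-beyond-∈PT : ∀ {k i n m} → pIter k n ≡ m → k < i → pIter i n ∈PT m
pIter-beyond-∈PT {k} {i} {n} ek k<i =
  i ∸ k , m<n⇒0<n∸m k<i ,
  trans (cong (pIter (i ∸ k)) (sym ek)) (pIter-split n (<⇒≤ k<i))

pIter-upto-∉PT : ∀ {k j n m} → pIter k n ≡ m → j ≤ k → ¬ (pIter j n ∈PT m)
pIter-upto-∉PT {n = n} ek j≤k x∈ =
  <⇒≱ (∈PT⇒> x∈) (subst (_ ≤_) ek (pIter-monoˡ-≤ n j≤k))

theorem5 : (n m : ℕ) → 1 ≤ n → n < m →
    ((Σ ℕ (λ x → (x ∈PT n) × (x ∈PT m))) ⇔ (m ∈PT n))
    × ((k : ℕ) → 1 ≤ k → pIter k n ≡ m →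
        ((x : ℕ) → x ∈PT m → x ∈PT n)
        × ((x : ℕ) → ((x ∈PT n) × ¬ (x ∈PT m))
                      ⇔ Σ ℕ (λ j → (1 ≤ j) × (j ≤ k) × (pIter j n ≡ x))))
theorem5 n m 1≤n n<m = mk⇔ common⇒∈PT ∈PT⇒common , λ k _ ek →
  (λ _ → ∈PT-trans {k} ek) , λ x → mk⇔ (initial-segment k ek) (λ (j , 1≤j , j≤k , e) →
    (j , 1≤j , e) , subst (λ y → ¬ (y ∈PT m)) e (pIter-upto-∉PT ek j≤k))
  where
  common⇒∈PT : Σ ℕ (λ x → (x ∈PT n) × (x ∈PT m)) → m ∈PT n
  common⇒∈PT (_ , (i , _ , ei) , (j , _ , ej))
    with pIter-common i j 1≤n (≤-trans 1≤n (<⇒≤ n<m)) (trans ei (sym ej))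
  ... | inj₁ (zero  , n≡m) = ⊥-elim (<-irrefl n≡m n<m)
  ... | inj₁ (suc d , e)   = suc d , s≤s z≤n , e
  ... | inj₂ (d , e)       = ⊥-elim (<⇒≱ n<m (subst (m ≤_) e (pIter-inflationary d m)))

  ∈PT⇒common : m ∈PT n → Σ ℕ (λ x → (x ∈PT n) × (x ∈PT m))
  ∈PT⇒common (k , _ , e) = p m , (suc k , s≤s z≤n , cong p e) , (1 , s≤s z≤n , refl)

  initial-segment : ∀ k {x} → pIter k n ≡ m → (x ∈PT n) × ¬ (x ∈PT m) →
    Σ ℕ (λ j → (1 ≤ j) × (j ≤ k) × (pIter j n ≡ x))
  initial-segment k ek ((i , 1≤i , e) , x∉) with i ≤? k
  ... | yes i≤k = i , 1≤i , i≤k , e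
  ... | no  i≰k = ⊥-elim (x∉ (subst (_∈PT m) e (pIter-beyond-∈PT ek (≰⇒> i≰k))))
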